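{- Let $1\le k<n$, $w=(y_1,\dots,y_{k-r},\overline{z_r},\dots,\overline{z_1},v_1,\dots,v_{n-k-1},\widehat{v_{n-k}})\in W^{OG(k,2n)}$ and $\lambda=\lambda(w)$. Then for $1\le i\le k$, \[\lambda^{(1)}_i=\begin{cases}n-k+|\{l:z_i<v_l\}| & i\le r\\ |\{l:y_{k+1-i}>v_l\}| & i>r\end{cases},\qquad \lambda^{(2)}_i=\begin{cases}|\{q:z_i<z_q\}|+|\{t:z_i<y_t\}| & i\le r\\ 0 & i>r,\end{cases}\] and if $\lambda^{(1)}_i=n-k$ for some $i$, then $\lambda$ is assigned $\uparrow$ if $w$ is of type I and $\downarrow$ if $w$ is of type II.
   Context: $W^{OG(k,2n)}$: signed permutations with an even number of barred (negative) entries of the form $(y_1,\dots,y_{k-r},\overline{z_r},\dots,\overline{z_1},v_1,\dots,v_{n-k-1},\widehat{v_{n-k}})$, $0\le r\le k$, $\{y\}\cup\{z\}\cup\{v\}=\{1,\dots,n\}$, $y_1<\dots<y_{k-r}$, $z_r>\dots>z_1$, $v_1<\dots<v_{n-k}$, $\widehat{v_{n-k}}\in\{v_{n-k},\overline{v_{n-k}}\}$; $w$ is of type I if its last entry is unbarred and type II otherwise. $w(e_a)=e_m$ if the $a$-th entry is $m$, $-e_m$ if it is $\overline m$. Type $D_n$ positive roots are $e_a\pm e_b$ ($a<b$); $\lambda(w)=\{\alpha>0:w(\alpha)<0\}$. For a set $S$ of roots: $S^{(1)}_i=|S\cap\{e_{k+1-i}\pm e_c:c>k\}|$, $S^{(2)}_i=|\{a<k+1-i:e_a+e_{k+1-i}\in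 S\}|$; if $S^{(1)}_i=n-k$ for some $i$, $S$ is assigned $\uparrow$ if $e_{k+1-i}-e_n\in S$ and $\downarrow$ if $e_{k+1-i}+e_n\in S$. -}

module Defs where

open import Data.Nat using (ℕ; zero; suc; _+_; _∸_; _<ᵇ_; _≤ᵇ_)
open import Data.Bool using (Bool; true; false; not; _∧_; _∨_; if_then_else_)
open import Data.List using (List; []; _∷_; _++_; map; reverse; upTo; concatMap)
open import Data.Product using (_×_; _,_; proj₁; proj₂)
open import Relation.Binary.PropositionalEquality using (_≡_)

-- A signed entry of a signed permutation in one-line notation:
-- (barred? , value).  (true , m) stands for \overline{m}.
SEntry : Set
SEntry = Bool × ℕ

-- change the sign-marker of the last entry of a word (the "hat" on v_{n-k})
markLast : Bool → List SEntry → List SEntry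
markLast b []               = []
markLast b ((_ , m) ∷ [])   = (b , m) ∷ []
markLast b (x ∷ y ∷ xs)     = x ∷ markLast b (y ∷ xs)

-- The word (y_1,…,y_{k-r}, \bar z_r,…,\bar z_1, v_1,…,v_{n-k-1}, \hat v_{n-k})
-- from the lists ys = [y_1,…], zs = [z_1,…,z_r], vs = [v_1,…,v_{n-k}],
-- and b = true iff the last entry is barred.
ogWord : List ℕ → List ℕ → List ℕ → Bool → List SEntry
ogWord ys zs vs b =
  map (false ,_) ys ++ map (true ,_) (reverse zs) ++ markLast b (map (false ,_) vs)

-- 1-based lookup of the a-th entry of a word (junk value outside range)
entry : List SEntry → ℕ → SEntry
entry []       _             = (false , 0)
entry (x ∷ xs) zero          = (false , 0)
entry (x ∷ xs) (suc zero)    = x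
entry (x ∷ xs) (suc (suc a)) = entry xs (suc a)

-- 1-based lookup in a list of naturals (junk value 0 outside range)
at : List ℕ → ℕ → ℕ
at []       _             = 0
at (x ∷ xs) zero          = 0
at (x ∷ xs) (suc zero)    = x
at (x ∷ xs) (suc (suc a)) = at xs (suc a)

numBarred : List SEntry → ℕ
numBarred []             = 0
numBarred ((s , _) ∷ xs) = if s then suc (numBarred xs) else numBarred xs

-- Roots e_a - e_b and e_a + e_b (indices 1-based).
data Root : Set where
  _⊖_ : ℕ → ℕ → Root
  _⊕_ : ℕ → ℕ → Root

isPosRoot : ℕ → Root → Bool
isPosRoot n (a ⊖ b) = (1 ≤ᵇ a) ∧ (a <ᵇ b) ∧ (b ≤ᵇ n)
isPosRoot n (a ⊕ b) = (1 ≤ᵇ a) ∧ (a <ᵇ b) ∧ (b ≤ᵇ n)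

-- a vector (-1)^s e_p + (-1)^t e_q  (p ≠ q), encoded as ((s , p) , (t , q))
Comb : Set
Comb = SEntry × SEntry

-- positive (in the D_n sense: of the form e_i ± e_j with i < j)
isPosComb : Comb → Bool
isPosComb ((s , p) , (t , q)) = ((p <ᵇ q) ∧ not s) ∨ ((q <ᵇ p) ∧ not t)

negComb : Comb → Comb
negComb ((s , p) , (t , q)) = ((not s , p) , (not t , q))

isNegComb : Comb → Bool
isNegComb c = isPosComb (negComb c)

flipS : SEntry → SEntry
flipS (s , m) = (not s , m)

-- action of the signed permutation w on a root:
-- w(e_a) = e_m if the a-th entry is m, -e_m if it is \bar m.
act : List SEntry → Root → Comb
act w (a ⊖ b) = (entry w a , flipS (entry w b))
act w (a ⊕ b) = (entry w a , entry w b)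

RootSet : Set
RootSet = Root → Bool

-- λ(w) = { α > 0 : w(α) < 0 } for w ∈ W(D_n)
inversionSet : ℕ → List SEntry → RootSet
inversionSet n w α = isPosRoot n α ∧ isNegComb (act w α)

count : {A : Set} → (A → Bool) → List A → ℕ
count p []       = 0
count p (x ∷ xs) = if p x then suc (count p xs) else count p xs

-- the list [a, a+1, …, b]  (empty if b < a)
between : ℕ → ℕ → List ℕ
between a b = map (a +_) (upTo (suc b ∸ a))

S1 : ℕ → ℕ → RootSet → ℕ → ℕ
S1 n k S i = count S (concatMap (λ c → (p ⊖ c) ∷ (p ⊕ c) ∷ []) (between (suc k) n))
  where p = suc k ∸ i

S2 : ℕ → RootSet → ℕ → ℕ
S2 k S i = count (λ a → S (a ⊕ p)) (between 1 (p ∸ 1))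
  where p = suc k ∸ i

data Arrow : Set where
  ↑ ↓ : Arrow

Assigned : ℕ → ℕ → RootSet → ℕ → Arrow → Set
Assigned n k S i ↑ = S ((suc k ∸ i) ⊖ n) ≡ true
Assigned n k S i ↓ = S ((suc k ∸ i) ⊕ n) ≡ true

module Submission where

-- Row i refers to the position p = k+1-i of w.  All roots e_p ± e_c (c > k) and
-- e_a + e_p (a < p) are positive, so for ANY signed word (tail-as-sum, head-as-count)
--   λ^(1)_i = Σ_{c>k} pairInv(w_p, w_c),   λ^(2)_i = #{a < p : w(e_a + e_p) < 0},
-- where pairInv(w_p, w_c) ∈ {0,1,2} counts the negative ones among w(e_p ∓ e_c).
-- For our w the w_c (c > k) are the v's; w_p = z̄_i if i ≤ r and w_p = y_{k+1-i}
-- if i > r.  The local contributions depend on signs and order only: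
-- pairInv(z̄, v) = 1 + [z < v], pairInv(y, v) = [v < y]; in front of z̄ a y
-- contributes [z < y] and a z̄_q (q > i) contributes 1, in front of y nothing does.
-- Finally, λ^(1)_i = n-k makes w_p - e_v negative for the last entry v̂; this is
-- w(e_p - e_n) if v̂ = v (type I, ↑) and w(e_p + e_n) if v̂ = v̄ (type II, ↓).

open import Defs
open import Data.Nat using (ℕ; zero; suc; _+_; _∸_; _≤_; _<_; _<ᵇ_; _≤?_; z≤n; s≤s; s≤s⁻¹)
open import Data.Nat.Properties
open import Data.Nat.ListAction using (sum)
open import Data.Nat.Divisibility using (_∣_)
open import Data.Bool using (Bool; true; false; _∨_; if_then_else_)
open import Data.Bool.Properties using (∧-zeroʳ; ∧-identityʳ; ∨-zeroʳ; T-≡)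
open import Data.List using (List; []; _∷_; _++_; _∷ʳ_; [_]; map; reverse; upTo; applyUpTo;
  concatMap; length; initLast; _∷ʳ′_)
open import Data.List.Properties using (++-assoc; ++-identityʳ; length-++; length-map;
  length-reverse; map-∘; map-cong; map-cong-local; map-applyUpTo; map-++; reverse-++;
  unfold-reverse; concatMap-pure)
open import Data.List.Relation.Unary.All as All using (All; []; _∷_; universal)
import Data.List.Relation.Unary.All.Properties as All
import Data.List.Relation.Unary.Unique.Propositional.Properties as Unique
open import Data.List.Relation.Unary.AllPairs using (AllPairs; _∷_)
open import Data.List.Relation.Unary.Linked using (Linked)
open import Data.List.Relation.Unary.Linked.Properties using (Linked⇒AllPairs)
open import Data.List.Relation.Unary.Unique.Propositional using (Unique)
open import Data.List.Relation.Binary.Permutation.Propositional using (_↭_; ↭-sym; ↭⇒↭ₛ)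
open import Data.List.Relation.Binary.Permutation.Propositional.Properties using (All-resp-↭; ↭-reverse)
import Data.List.Relation.Binary.Permutation.Setoid.Properties as PermSetoid
open import Data.Product using (Σ; _×_; _,_; proj₁; proj₂)
open import Data.Empty using (⊥-elim)
open import Function using (_∘_; id; Equivalence)
open import Relation.Nullary using (¬_; Dec; yes; no)
open import Relation.Binary using (tri<; tri≈; tri>)
open import Relation.Binary.PropositionalEquality
  using (_≡_; _≢_; refl; sym; trans; cong; cong₂; subst; setoid; module ≡-Reasoning)
open import Algebra.Properties.CommutativeSemigroup +-commutativeSemigroup using (x∙yz≈y∙xz)

open ≡-Reasoning

private variable A B : Set

count-++ : (q : A → Bool) (xs ys : List A) → count q (xs ++ ys) ≡ count q xs + count q ys
count-++ q []       ys = refl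
count-++ q (x ∷ xs) ys with q x
... | true  = cong suc (count-++ q xs ys)
... | false = count-++ q xs ys

count-map : (q : B → Bool) (f : A → B) (xs : List A) → count q (map f xs) ≡ count (q ∘ f) xs
count-map q f []       = refl
count-map q f (x ∷ xs) with q (f x)
... | true  = cong suc (count-map q f xs)
... | false = count-map q f xs

count-concatMap : (q : B → Bool) (g : A → List B) (xs : List A) →
  count q (concatMap g xs) ≡ sum (map (count q ∘ g) xs)
count-concatMap q g []       = refl
count-concatMap q g (x ∷ xs) =
  trans (count-++ q (g x) (concatMap g xs)) (cong (count q (g x) +_) (count-concatMap q g xs))

count-cong-local : {q q′ : A → Bool} {xs : List A} →
  All (λ x → q x ≡ q′ x) xs → count q xs ≡ count q′ xs
count-cong-local []                         = refl
count-cong-local {q′ = q′} {x ∷ _} (e ∷ es) rewrite e =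
  cong (λ m → if q′ x then suc m else m) (count-cong-local es)

count-none : (q : A → Bool) {xs : List A} → All (λ x → q x ≡ false) xs → count q xs ≡ 0
count-none q []       = refl
count-none q (e ∷ es) rewrite e = count-none q es

count-every : (q : A → Bool) {xs : List A} → All (λ x → q x ≡ true) xs → count q xs ≡ length xs
count-every q []       = refl
count-every q (e ∷ es) rewrite e = cong suc (count-every q es)

count-≤-length : (q : A → Bool) (xs : List A) → count q xs ≤ length xs
count-≤-length q []       = z≤n
count-≤-length q (x ∷ xs) with q x
... | true  = s≤s (count-≤-length q xs)
... | false = m≤n⇒m≤1+n (count-≤-length q xs)

count-full : (q : A → Bool) (xs : List A) → count q xs ≡ length xs → All (λ x → q x ≡ true) xs
count-full q []       _ = []
count-full q (x ∷ xs) e with q x in qx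
... | true  = qx ∷ count-full q xs (suc-injective e)
... | false = ⊥-elim (<-irrefl e (s≤s (count-≤-length q xs)))

sum-singleton-counts : (q : A → Bool) (xs : List A) →
  sum (map (λ x → count q [ x ]) xs) ≡ count q xs
sum-singleton-counts q xs = trans (sym (count-concatMap q [_] xs)) (cong (count q) (concatMap-pure xs))

sum-map-suc : (f : A → ℕ) (xs : List A) → sum (map (suc ∘ f) xs) ≡ length xs + sum (map f xs)
sum-map-suc f []       = refl
sum-map-suc f (x ∷ xs) = cong suc (trans (cong (f x +_) (sum-map-suc f xs)) (x∙yz≈y∙xz (f x) (length xs) _))

entry-shift : (P W : List SEntry) (j : ℕ) → entry (P ++ W) (suc (length P + j)) ≡ entry W (suc j)
entry-shift []      W j = refl
entry-shift (_ ∷ P) W j = entry-shift P W j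

entry-mid : (P : List SEntry) (x : SEntry) (R : List SEntry) → entry (P ++ x ∷ R) (suc (length P)) ≡ x
entry-mid []      x R = refl
entry-mid (_ ∷ P) x R = entry-mid P x R

at-mid : (P : List ℕ) (x : ℕ) (R : List ℕ) → at (P ++ x ∷ R) (suc (length P)) ≡ x
at-mid []      x R = refl
at-mid (_ ∷ P) x R = at-mid P x R

entries-prefix : (L R : List SEntry) → applyUpTo (λ j → entry (L ++ R) (suc j)) (length L) ≡ L
entries-prefix []      R = refl
entries-prefix (x ∷ L) R = cong (x ∷_) (entries-prefix L R)

entries-between : (P L R : List SEntry) →
  map (entry (P ++ L ++ R)) (between (suc (length P)) (length P + length L)) ≡ L
entries-between P L R = begin
  map (entry W) (map (suc (length P) +_) (upTo (length P + length L ∸ length P)))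
    ≡⟨ cong (λ m → map (entry W) (map (suc (length P) +_) (upTo m))) (m+n∸m≡n (length P) (length L)) ⟩
  map (entry W) (map (suc (length P) +_) (upTo (length L)))
    ≡⟨ map-∘ (upTo (length L)) ⟨
  map (λ j → entry W (suc (length P + j))) (upTo (length L))
    ≡⟨ map-cong (entry-shift P (L ++ R)) (upTo (length L)) ⟩
  map (λ j → entry (L ++ R) (suc j)) (upTo (length L))
    ≡⟨ map-applyUpTo id _ (length L) ⟩
  applyUpTo (λ j → entry (L ++ R) (suc j)) (length L)
    ≡⟨ entries-prefix L R ⟩
  L ∎
  where
  W : List SEntry
  W = P ++ L ++ R

<-∸⇒+< : ∀ m a i → i < m ∸ a → a + i < m
<-∸⇒+< m       zero    i h = h
<-∸⇒+< zero    (suc a) i ()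
<-∸⇒+< (suc m) (suc a) i h = s≤s (<-∸⇒+< m a i h)

between-bounds : ∀ a b → All (λ c → a ≤ c × c ≤ b) (between a b)
between-bounds a b = All.map⁺ (All.applyUpTo⁺₁ id (suc b ∸ a)
  (λ {i} i< → m≤m+n a i , s≤s⁻¹ (<-∸⇒+< (suc b) a i i<)))

All-last : {P : ℕ → Set} (V : List ℕ) {v : ℕ} → All P (V ∷ʳ v) → P v
All-last V all with All.++⁻ʳ V all
... | pv ∷ [] = pv

split-at : (L : List ℕ) (j : ℕ) → 1 ≤ j → j ≤ length L →
  Σ (List ℕ) λ A → Σ ℕ λ x → Σ (List ℕ) λ B → (L ≡ A ++ x ∷ B) × (suc (length A) ≡ j)
split-at (x ∷ L) (suc zero)    _ _          = [] , x , L , refl , refl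
split-at (x ∷ L) (suc (suc j)) _ (s≤s j≤L) with split-at L (suc j) (s≤s z≤n) j≤L
... | A , y , B , refl , refl = x ∷ A , y , B , refl , refl

AllPairs-around : {R : ℕ → ℕ → Set} (A : List ℕ) (x : ℕ) (B : List ℕ) → AllPairs R (A ++ x ∷ B) →
  All (λ a → R a x) A × All (R x) B
AllPairs-around []      x B (x~B ∷ _)   = [] , x~B
AllPairs-around (a ∷ A) x B (a~ ∷ rest) with All.++⁻ʳ A a~ | AllPairs-around A x B rest
... | a~x ∷ _ | A~x , x~B = a~x ∷ A~x , x~B

unique-between : ∀ n → Unique (between 1 n)
unique-between n = Unique.map⁺ suc-injective (Unique.upTo⁺ n)

unique-resp-↭ : {xs ys : List ℕ} → xs ↭ ys → Unique xs → Unique ys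
unique-resp-↭ p = PermSetoid.Unique-resp-↭ (setoid ℕ) (↭⇒↭ₛ p)

<ᵇ-true : ∀ {m n} → m < n → (m <ᵇ n) ≡ true
<ᵇ-true m<n = Equivalence.to T-≡ (<⇒<ᵇ m<n)

<ᵇ-false : ∀ {m n} → ¬ m < n → (m <ᵇ n) ≡ false
<ᵇ-false {m} {n} m≮n with m <ᵇ n in eq
... | true  = ⊥-elim (m≮n (<ᵇ⇒< m n (Equivalence.from T-≡ eq)))
... | false = refl

<ᵇ-either : ∀ {m n} → m ≢ n → (m <ᵇ n) ∨ (n <ᵇ m) ≡ true
<ᵇ-either {m} {n} m≢n with <-cmp m n
... | tri< m<n _ _ rewrite <ᵇ-true m<n = refl
... | tri≈ _ m≡n _ = ⊥-elim (m≢n m≡n)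
... | tri> _ _ n<m rewrite <ᵇ-true n<m = ∨-zeroʳ (m <ᵇ n)

-- isPosRoot ignores the sign of the root, so this covers e_a + e_b as well
isPosRoot⊖ : ∀ n a b → 1 ≤ a → a < b → b ≤ n → isPosRoot n (a ⊖ b) ≡ true
isPosRoot⊖ n a b 1≤a a<b b≤n
  rewrite Equivalence.to T-≡ (≤⇒≤ᵇ 1≤a) | <ᵇ-true a<b | Equivalence.to T-≡ (≤⇒≤ᵇ b≤n) = refl

neg-barred-barred : ∀ {x v} → x ≢ v → isNegComb ((true , x) , (true , v)) ≡ true
neg-barred-barred {x} {v} x≢v rewrite ∧-identityʳ (x <ᵇ v) | ∧-identityʳ (v <ᵇ x) = <ᵇ-either x≢v

neg-unbarred-barred : ∀ y v → isNegComb ((false , y) , (true , v)) ≡ (v <ᵇ y)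
neg-unbarred-barred y v rewrite ∧-zeroʳ (y <ᵇ v) | ∧-identityʳ (v <ᵇ y) = refl

neg-unbarred-unbarred : ∀ a y → isNegComb ((false , a) , (false , y)) ≡ false
neg-unbarred-unbarred a y rewrite ∧-zeroʳ (a <ᵇ y) | ∧-zeroʳ (y <ᵇ a) = refl

-- λ^(1) and λ^(2) of an arbitrary signed word, read at a position p

rootPair : ℕ → ℕ → List Root
rootPair p c = (p ⊖ c) ∷ (p ⊕ c) ∷ []

-- λ^(1) and λ^(2) at the row whose position in w is p; S1 n k S i and S2 k S i
-- are these at p = k+1-i
tailInversions : ℕ → ℕ → RootSet → ℕ → ℕ
tailInversions n k S p = count S (concatMap (rootPair p) (between (suc k) n))

headInversions : RootSet → ℕ → ℕ
headInversions S p = count (λ a → S (a ⊕ p)) (between 1 (p ∸ 1))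

pairInv : SEntry → SEntry → ℕ
pairInv e f = count isNegComb ((e , flipS f) ∷ (e , f) ∷ [])

ArrowsAt : ℕ → List SEntry → ℕ → Set
ArrowsAt n W p = (proj₁ (entry W n) ≡ false → inversionSet n W (p ⊖ n) ≡ true)
               × (proj₁ (entry W n) ≡ true → inversionSet n W (p ⊕ n) ≡ true)

tail-as-sum : ∀ n k p (W P M : List SEntry) → W ≡ P ++ M → length P ≡ k → k + length M ≡ n →
  1 ≤ p → p ≤ k → tailInversions n k (inversionSet n W) p ≡ sum (map (pairInv (entry W p)) M)
tail-as-sum _ _ p _ P M refl refl refl 1≤p p≤k = begin
  count S (concatMap (rootPair p) cs)                ≡⟨ count-concatMap S (rootPair p) cs ⟩
  sum (map (count S ∘ rootPair p) cs)                ≡⟨ cong sum (map-cong-local (All.map pair (between-bounds _ n))) ⟩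
  sum (map (pairInv wp ∘ entry W) cs)                ≡⟨ cong sum (map-∘ cs) ⟩
  sum (map (pairInv wp) (map (entry W) cs))          ≡⟨ cong (sum ∘ map (pairInv wp)) entries-of-M ⟩
  sum (map (pairInv wp) M)                           ∎
  where
  n : ℕ
  n = length P + length M
  W : List SEntry
  W = P ++ M
  S : RootSet
  S = inversionSet n W
  cs : List ℕ
  cs = between (suc (length P)) n
  wp : SEntry
  wp = entry W p
  pair : ∀ {c} → suc (length P) ≤ c × c ≤ n → count S (rootPair p c) ≡ pairInv wp (entry W c)
  pair {c} (lo , hi) rewrite isPosRoot⊖ n p c 1≤p (≤-<-trans p≤k lo) hi = refl
  entries-of-M : map (entry W) cs ≡ M
  entries-of-M = subst (λ X → map (entry (P ++ X)) cs ≡ M) (++-identityʳ M) (entries-between P M [])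

head-as-count : ∀ n p (W Q R : List SEntry) → W ≡ Q ++ R → suc (length Q) ≡ p → p ≤ n →
  headInversions (inversionSet n W) p ≡ count (λ e → isNegComb (e , entry W p)) Q
head-as-count n _ _ Q R refl refl p≤n = begin
  count (λ a → S (a ⊕ p)) cs                         ≡⟨ count-cong-local (All.map pair (between-bounds 1 (length Q))) ⟩
  count (negWith ∘ entry W) cs                       ≡⟨ count-map negWith (entry W) cs ⟨
  count negWith (map (entry W) cs)                   ≡⟨ cong (count negWith) (entries-between [] Q R) ⟩
  count negWith Q                                    ∎
  where
  p : ℕ
  p = suc (length Q)
  W : List SEntry
  W = Q ++ R
  S : RootSet
  S = inversionSet n W
  cs : List ℕ
  cs = between 1 (length Q)
  negWith : SEntry → Bool
  negWith e = isNegComb (e , entry W p)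
  pair : ∀ {a} → 1 ≤ a × a ≤ length Q → S (a ⊕ p) ≡ negWith (entry W a)
  pair {a} (lo , hi) rewrite isPosRoot⊖ n a p lo (s≤s hi) p≤n = refl

arrows-last : ∀ n p (W Pre : List SEntry) b v → W ≡ Pre ∷ʳ (b , v) → suc (length Pre) ≡ n →
  1 ≤ p → p < n → isNegComb (entry W p , (true , v)) ≡ true → ArrowsAt n W p
arrows-last _ p _ Pre b v refl refl 1≤p p<n neg
  rewrite entry-mid Pre (b , v) [] | isPosRoot⊖ (suc (length Pre)) p _ 1≤p p<n ≤-refl with b
... | false = (λ _ → neg) , (λ ())
... | true  = (λ ()) , (λ _ → neg)

unbarred barred : ℕ → SEntry
unbarred m = false , m
barred   m = true , m

markLast-snoc : ∀ b (V : List ℕ) v → markLast b (map unbarred (V ∷ʳ v)) ≡ map unbarred V ∷ʳ (b , v)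
markLast-snoc b []          v = refl
markLast-snoc b (x ∷ [])    v = refl
markLast-snoc b (x ∷ y ∷ V) v = cong ((false , x) ∷_) (markLast-snoc b (y ∷ V) v)

length-markLast : ∀ b (L : List SEntry) → length (markLast b L) ≡ length L
length-markLast b []          = refl
length-markLast b (x ∷ [])    = refl
length-markLast b (x ∷ y ∷ L) = cong suc (length-markLast b (y ∷ L))

sum-markLast : (f : SEntry → ℕ) (h : ℕ → ℕ) (b : Bool) (vs : List ℕ) →
  All (λ v → ∀ s → f (s , v) ≡ h v) vs → sum (map f (markLast b (map unbarred vs))) ≡ sum (map h vs)
sum-markLast f h b []          []           = refl
sum-markLast f h b (x ∷ [])    (e ∷ [])     = cong (_+ 0) (e b)
sum-markLast f h b (x ∷ y ∷ vs) (e ∷ es)    = cong₂ _+_ (e false) (sum-markLast f h b (y ∷ vs) es)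

front : List ℕ → List ℕ → List SEntry
front ys zs = map unbarred ys ++ map barred (reverse zs)

length-front : ∀ ys zs → length (front ys zs) ≡ length ys + length zs
length-front ys zs = trans (length-++ (map unbarred ys))
  (cong₂ _+_ (length-map _ ys) (trans (length-map _ (reverse zs)) (length-reverse zs)))

tail-ogWord : ∀ n k p ys zs vs b → length ys + length zs ≡ k → k + length vs ≡ n → 1 ≤ p → p ≤ k →
  tailInversions n k (inversionSet n (ogWord ys zs vs b)) p
    ≡ sum (map (pairInv (entry (ogWord ys zs vs b) p)) (markLast b (map unbarred vs)))
tail-ogWord n k p ys zs vs b hk hn =
  tail-as-sum n k p _ (front ys zs) _
    (sym (++-assoc (map unbarred ys) _ _))
    (trans (length-front ys zs) hk)
    (trans (cong (k +_) (trans (length-markLast b (map unbarred vs)) (length-map unbarred vs))) hn)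

arrows-ogWord : ∀ n k p ys zs vs b → length ys + length zs ≡ k → k + length vs ≡ n → k < n →
  1 ≤ p → p ≤ k → All (λ v → isNegComb (entry (ogWord ys zs vs b) p , (true , v)) ≡ true) vs →
  ArrowsAt n (ogWord ys zs vs b) p
arrows-ogWord n k p ys zs vs b hk hn k<n 1≤p p≤k neg with initLast vs
... | [] = ⊥-elim (<-irrefl (trans (sym (+-identityʳ k)) hn) k<n)
... | V ∷ʳ′ v = arrows-last n p _ Pre b v W≡ n≡ 1≤p (≤-<-trans p≤k k<n) (All-last V neg)
  where
  Pre = front ys zs ++ map unbarred V
  W≡ : ogWord ys zs (V ∷ʳ v) b ≡ Pre ∷ʳ (b , v)
  W≡ = begin
    map unbarred ys ++ map barred (reverse zs) ++ markLast b (map unbarred (V ∷ʳ v))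
      ≡⟨ cong (λ X → map unbarred ys ++ map barred (reverse zs) ++ X) (markLast-snoc b V v) ⟩
    map unbarred ys ++ map barred (reverse zs) ++ map unbarred V ∷ʳ (b , v)
      ≡⟨ cong (map unbarred ys ++_) (sym (++-assoc (map barred (reverse zs)) _ _)) ⟩
    map unbarred ys ++ (map barred (reverse zs) ++ map unbarred V) ∷ʳ (b , v)
      ≡⟨ sym (++-assoc (map unbarred ys) _ _) ⟩
    (map unbarred ys ++ map barred (reverse zs) ++ map unbarred V) ∷ʳ (b , v)
      ≡⟨ cong (_∷ʳ (b , v)) (sym (++-assoc (map unbarred ys) _ _)) ⟩
    Pre ∷ʳ (b , v) ∎
  n≡ : suc (length Pre) ≡ n
  n≡ = begin
    suc (length Pre)                            ≡⟨ cong suc (length-++ (front ys zs)) ⟩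
    suc (length (front ys zs) + length (map unbarred V))
                                                ≡⟨ cong suc (cong₂ _+_ (trans (length-front ys zs) hk) (length-map _ V)) ⟩
    suc (k + length V)                          ≡⟨ +-suc k (length V) ⟨
    k + suc (length V)                          ≡⟨ cong (k +_) (trans (+-comm 1 (length V)) (sym (length-++ V))) ⟩
    k + length (V ∷ʳ v)                         ≡⟨ hn ⟩
    n ∎

-- w_p = z̄ and w_c = ±v (v ≠ z): w(e_p ± e_c) = -e_z ± e_v, one of the two is
-- negative, the other one iff z < v
pairInv-barred : ∀ {z v} → z ≢ v → ∀ s → pairInv (barred z) (s , v) ≡ suc (count (z <ᵇ_) [ v ])
pairInv-barred {z} {v} z≢v s with <-cmp z v
... | tri< z<v _ _ rewrite <ᵇ-true z<v = refl
... | tri≈ _ z≡v _ = ⊥-elim (z≢v z≡v)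
... | tri> _ _ v<z rewrite <ᵇ-true v<z | <ᵇ-false (<⇒≯ v<z) with s
...   | true  = refl
...   | false = refl

-- w_p = y and w_c = ±v: exactly one of e_y ∓ e_v is negative if v < y, none otherwise
pairInv-unbarred : ∀ y v s → pairInv (unbarred y) (s , v) ≡ count (_<ᵇ y) [ v ]
pairInv-unbarred y v s rewrite ∧-zeroʳ (y <ᵇ v) with v <ᵇ y | s
... | true  | true  = refl
... | true  | false = refl
... | false | _     = refl

-- Row i ≤ r : here w_p = z̄_i

reverse-around : (A : List ℕ) (z : ℕ) (B : List ℕ) → reverse (A ++ z ∷ B) ≡ reverse B ++ z ∷ reverse A
reverse-around A z B = trans (reverse-++ A (z ∷ B))
  (trans (cong (_++ reverse A) (unfold-reverse z B)) (++-assoc (reverse B) [ z ] (reverse A)))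

barred-split : ∀ ys A z B vs b → ogWord ys (A ++ z ∷ B) vs b
  ≡ front ys B ++ barred z ∷ (map barred (reverse A) ++ markLast b (map unbarred vs))
barred-split ys A z B vs b = begin
  Y ++ map barred (reverse (A ++ z ∷ B)) ++ M
    ≡⟨ cong (λ X → Y ++ map barred X ++ M) (reverse-around A z B) ⟩
  Y ++ map barred (reverse B ++ z ∷ reverse A) ++ M
    ≡⟨ cong (λ X → Y ++ X ++ M) (map-++ barred (reverse B) (z ∷ reverse A)) ⟩
  Y ++ (map barred (reverse B) ++ barred z ∷ map barred (reverse A)) ++ M
    ≡⟨ cong (Y ++_) (++-assoc (map barred (reverse B)) _ M) ⟩
  Y ++ map barred (reverse B) ++ barred z ∷ map barred (reverse A) ++ M
    ≡⟨ ++-assoc Y (map barred (reverse B)) _ ⟨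
  front ys B ++ barred z ∷ (map barred (reverse A) ++ M) ∎
  where
  Y M : List SEntry
  Y = map unbarred ys
  M = markLast b (map unbarred vs)

-- z̄_i sits at position k+1-i = |ys| + (r - i) + 1
barred-position : ∀ {k} (ys A : List ℕ) z (B : List ℕ) → length ys + length (A ++ z ∷ B) ≡ k →
  suc (length ys + length B) ≡ k ∸ length A
barred-position {k} ys A z B hk = sym (begin
  k ∸ length A                                    ≡⟨ cong (_∸ length A) hk ⟨
  length ys + length (A ++ z ∷ B) ∸ length A      ≡⟨ cong (λ m → length ys + m ∸ length A) (length-++ A) ⟩
  length ys + (length A + suc (length B)) ∸ length A
                                                  ≡⟨ cong (_∸ length A) (x∙yz≈y∙xz (length ys) (length A) _) ⟩
  length A + (length ys + suc (length B)) ∸ length A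
                                                  ≡⟨ m+n∸m≡n (length A) _ ⟩
  length ys + suc (length B)                      ≡⟨ +-suc (length ys) (length B) ⟩
  suc (length ys + length B)                      ∎)

count-above-sorted : (A : List ℕ) (z : ℕ) (B : List ℕ) → AllPairs _<_ (A ++ z ∷ B) →
  count (z <ᵇ_) (A ++ z ∷ B) ≡ length B
count-above-sorted A z B sorted with AllPairs-around A z B sorted
... | A<z , z<B rewrite count-++ (z <ᵇ_) A (z ∷ B)
                      | count-none (z <ᵇ_) (All.map (λ a<z → <ᵇ-false (<⇒≯ a<z)) A<z)
                      | <ᵇ-false (n≮n z) = count-every (z <ᵇ_) (All.map <ᵇ-true z<B)

-- in front of z̄_i: the y's (negative with z̄ iff z < y) and z̄_q for q > i (always negative)
head-count-barred : ∀ ys z B → All (z <_) B →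
  count (λ e → isNegComb (e , barred z)) (front ys B) ≡ count (z <ᵇ_) ys + length B
head-count-barred ys z B z<B = begin
  count negZ (front ys B)
    ≡⟨ count-++ negZ (map unbarred ys) _ ⟩
  count negZ (map unbarred ys) + count negZ (map barred (reverse B))
    ≡⟨ cong₂ _+_ (count-map negZ unbarred ys) (count-map negZ barred (reverse B)) ⟩
  count (negZ ∘ unbarred) ys + count (negZ ∘ barred) (reverse B)
    ≡⟨ cong₂ _+_ (count-cong-local (universal (λ y → neg-unbarred-barred y z) ys))
                 (count-every (negZ ∘ barred) (All-resp-↭ (↭-sym (↭-reverse B)) (All.map (λ z<q → neg-barred-barred (>⇒≢ z<q)) z<B))) ⟩
  count (z <ᵇ_) ys + length (reverse B)
    ≡⟨ cong (count (z <ᵇ_) ys +_) (length-reverse B) ⟩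
  count (z <ᵇ_) ys + length B ∎
  where
  negZ : SEntry → Bool
  negZ e = isNegComb (e , barred z)

barred-row : ∀ n k p ys A z B vs b → length ys + length (A ++ z ∷ B) ≡ k → k + length vs ≡ n → k < n →
  suc (length ys + length B) ≡ p → p ≤ k → All (z ≢_) vs → AllPairs _<_ (A ++ z ∷ B) →
  (tailInversions n k (inversionSet n (ogWord ys (A ++ z ∷ B) vs b)) p ≡ length vs + count (z <ᵇ_) vs)
  × (headInversions (inversionSet n (ogWord ys (A ++ z ∷ B) vs b)) p
       ≡ count (z <ᵇ_) (A ++ z ∷ B) + count (z <ᵇ_) ys)
  × ArrowsAt n (ogWord ys (A ++ z ∷ B) vs b) p
barred-row n k p ys A z B vs b hk hn k<n hp p≤k z∉vs sorted = tail , head , arrows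
  where
  W M : List SEntry
  W = ogWord ys (A ++ z ∷ B) vs b
  M = markLast b (map unbarred vs)
  1≤p : 1 ≤ p
  1≤p = subst (1 ≤_) hp (s≤s z≤n)
  p≡ : suc (length (front ys B)) ≡ p
  p≡ = trans (cong suc (length-front ys B)) hp
  wp : entry W p ≡ barred z
  wp = trans (cong₂ entry (barred-split ys A z B vs b) (sym p≡)) (entry-mid (front ys B) (barred z) _)
  tail : tailInversions n k (inversionSet n W) p ≡ length vs + count (z <ᵇ_) vs
  tail = begin
    tailInversions n k (inversionSet n W) p            ≡⟨ tail-ogWord n k p ys (A ++ z ∷ B) vs b hk hn 1≤p p≤k ⟩
    sum (map (pairInv (entry W p)) M)                  ≡⟨ cong (λ e → sum (map (pairInv e) M)) wp ⟩
    sum (map (pairInv (barred z)) M)                   ≡⟨ sum-markLast _ _ b vs (All.map pairInv-barred z∉vs) ⟩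
    sum (map (suc ∘ λ v → count (z <ᵇ_) [ v ]) vs)     ≡⟨ sum-map-suc _ vs ⟩
    length vs + sum (map (λ v → count (z <ᵇ_) [ v ]) vs) ≡⟨ cong (length vs +_) (sum-singleton-counts _ vs) ⟩
    length vs + count (z <ᵇ_) vs                       ∎
  head : headInversions (inversionSet n W) p ≡ count (z <ᵇ_) (A ++ z ∷ B) + count (z <ᵇ_) ys
  head = begin
    headInversions (inversionSet n W) p
      ≡⟨ head-as-count n p W (front ys B) _ (barred-split ys A z B vs b) p≡ (≤-trans p≤k (<⇒≤ k<n)) ⟩
    count (λ e → isNegComb (e , entry W p)) (front ys B)
      ≡⟨ cong (λ x → count (λ e → isNegComb (e , x)) (front ys B)) wp ⟩
    count (λ e → isNegComb (e , barred z)) (front ys B)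
      ≡⟨ head-count-barred ys z B (proj₂ (AllPairs-around A z B sorted)) ⟩
    count (z <ᵇ_) ys + length B
      ≡⟨ +-comm _ (length B) ⟩
    length B + count (z <ᵇ_) ys
      ≡⟨ cong (_+ count (z <ᵇ_) ys) (count-above-sorted A z B sorted) ⟨
    count (z <ᵇ_) (A ++ z ∷ B) + count (z <ᵇ_) ys ∎
  arrows : ArrowsAt n W p
  arrows = arrows-ogWord n k p ys (A ++ z ∷ B) vs b hk hn k<n 1≤p p≤k
    (All.map (λ z≢v → trans (cong (λ e → isNegComb (e , barred _)) wp) (neg-barred-barred z≢v)) z∉vs)

-- Row i > r : here w_p = y_{k+1-i}

unbarred-split : ∀ A y B zs vs b → ogWord (A ++ y ∷ B) zs vs b
  ≡ map unbarred A ++ unbarred y ∷ (map unbarred B ++ map barred (reverse zs) ++ markLast b (map unbarred vs))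
unbarred-split A y B zs vs b =
  trans (cong (_++ _) (map-++ unbarred A (y ∷ B))) (++-assoc (map unbarred A) _ _)

unbarred-row : ∀ n k p A y B zs vs b → length (A ++ y ∷ B) + length zs ≡ k → k + length vs ≡ n → k < n →
  suc (length A) ≡ p → p ≤ k →
  (tailInversions n k (inversionSet n (ogWord (A ++ y ∷ B) zs vs b)) p ≡ count (_<ᵇ y) vs)
  × (headInversions (inversionSet n (ogWord (A ++ y ∷ B) zs vs b)) p ≡ 0)
  × (tailInversions n k (inversionSet n (ogWord (A ++ y ∷ B) zs vs b)) p ≡ length vs →
       ArrowsAt n (ogWord (A ++ y ∷ B) zs vs b) p)
unbarred-row n k p A y B zs vs b hk hn k<n hp p≤k = tail , head , arrows
  where
  W M : List SEntry
  W = ogWord (A ++ y ∷ B) zs vs b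
  M = markLast b (map unbarred vs)
  1≤p : 1 ≤ p
  1≤p = subst (1 ≤_) hp (s≤s z≤n)
  p≡ : suc (length (map unbarred A)) ≡ p
  p≡ = trans (cong suc (length-map unbarred A)) hp
  wp : entry W p ≡ unbarred y
  wp = trans (cong₂ entry (unbarred-split A y B zs vs b) (sym p≡)) (entry-mid (map unbarred A) (unbarred y) _)
  tail : tailInversions n k (inversionSet n W) p ≡ count (_<ᵇ y) vs
  tail = begin
    tailInversions n k (inversionSet n W) p            ≡⟨ tail-ogWord n k p (A ++ y ∷ B) zs vs b hk hn 1≤p p≤k ⟩
    sum (map (pairInv (entry W p)) M)                  ≡⟨ cong (λ e → sum (map (pairInv e) M)) wp ⟩
    sum (map (pairInv (unbarred y)) M)                 ≡⟨ sum-markLast _ _ b vs (universal (pairInv-unbarred y) vs) ⟩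
    sum (map (λ v → count (_<ᵇ y) [ v ]) vs)           ≡⟨ sum-singleton-counts _ vs ⟩
    count (_<ᵇ y) vs                                   ∎
  head : headInversions (inversionSet n W) p ≡ 0
  head = begin
    headInversions (inversionSet n W) p
      ≡⟨ head-as-count n p W (map unbarred A) _ (unbarred-split A y B zs vs b) p≡ (≤-trans p≤k (<⇒≤ k<n)) ⟩
    count (λ e → isNegComb (e , entry W p)) (map unbarred A)
      ≡⟨ cong (λ x → count (λ e → isNegComb (e , x)) (map unbarred A)) wp ⟩
    count (λ e → isNegComb (e , unbarred y)) (map unbarred A)
      ≡⟨ count-map _ unbarred A ⟩
    count (λ a → isNegComb (unbarred a , unbarred y)) A
      ≡⟨ count-none _ (universal (λ a → neg-unbarred-unbarred a y) A) ⟩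
    0 ∎
  -- λ^(1)_i = n-k forces v < y for every v, in particular for the last one
  arrows : tailInversions n k (inversionSet n W) p ≡ length vs → ArrowsAt n W p
  arrows full = arrows-ogWord n k p (A ++ y ∷ B) zs vs b hk hn k<n 1≤p p≤k
    (All.map (λ v<y → trans (cong (λ e → isNegComb (e , barred _)) wp) (trans (neg-unbarred-barred y _) v<y))
      (count-full (_<ᵇ y) vs (trans (sym tail) full)))

RowClaims : ℕ → ℕ → ℕ → List ℕ → List ℕ → List ℕ → Bool → ℕ → Set
RowClaims n k r ys zs vs b i =
  (i ≤ r →
    (S1 n k (inversionSet n (ogWord ys zs vs b)) i ≡ (n ∸ k) + count (λ v → at zs i <ᵇ v) vs)
    × (S2 k (inversionSet n (ogWord ys zs vs b)) i
       ≡ count (λ z → at zs i <ᵇ z) zs + count (λ y → at zs i <ᵇ y) ys))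
  × (r < i →
    (S1 n k (inversionSet n (ogWord ys zs vs b)) i ≡ count (λ v → v <ᵇ at ys (k + 1 ∸ i)) vs)
    × (S2 k (inversionSet n (ogWord ys zs vs b)) i ≡ 0))
  × (S1 n k (inversionSet n (ogWord ys zs vs b)) i ≡ n ∸ k →
    (proj₁ (entry (ogWord ys zs vs b) n) ≡ false → Assigned n k (inversionSet n (ogWord ys zs vs b)) i ↑)
    × (proj₁ (entry (ogWord ys zs vs b) n) ≡ true → Assigned n k (inversionSet n (ogWord ys zs vs b)) i ↓))

distinct-from-vs : ∀ ys A z B (vs : List ℕ) → Unique (ys ++ (A ++ z ∷ B) ++ vs) → All (z ≢_) vs
distinct-from-vs ys A z B vs distinct = All.++⁻ʳ B (proj₂ (AllPairs-around (ys ++ A) z (B ++ vs)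
  (subst Unique (trans (cong (ys ++_) (++-assoc A (z ∷ B) vs)) (sym (++-assoc ys A _))) distinct)))

position-≤ : ∀ k i → 1 ≤ i → suc k ∸ i ≤ k
position-≤ k (suc i) _ = m∸n≤m k i

barred-claims : ∀ n k r ys zs vs b i → length ys + length zs ≡ k → k + length vs ≡ n → k < n →
  length zs ≡ r → length vs ≡ n ∸ k → Unique (ys ++ zs ++ vs) → Linked _<_ zs →
  1 ≤ i → i ≤ r → RowClaims n k r ys zs vs b i
barred-claims n k r ys zs vs b i hk hn k<n |zs| |vs| distinct sorted 1≤i i≤r
  with split-at zs i 1≤i (subst (i ≤_) (sym |zs|) i≤r)
... | A , z , B , refl , refl
  with barred-row n k (k ∸ length A) ys A z B vs b hk hn k<n (barred-position ys A z B hk)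
         (m∸n≤m k (length A)) (distinct-from-vs ys A z B vs distinct) (Linked⇒AllPairs <-trans sorted)
... | tail , head , arrows =
  (λ _ → trans tail (cong₂ (λ m t → m + count (t <ᵇ_) vs) |vs| (sym (at-mid A z B)))
       , trans head (cong (λ t → count (t <ᵇ_) (A ++ z ∷ B) + count (t <ᵇ_) ys) (sym (at-mid A z B))))
  , (λ r<i → ⊥-elim (<⇒≱ r<i i≤r))
  , (λ _ → arrows)

at-row : ∀ k i (A : List ℕ) y B → suc (length A) ≡ suc k ∸ i → at (A ++ y ∷ B) (k + 1 ∸ i) ≡ y
at-row k i A y B hp = trans (cong (λ m → at (A ++ y ∷ B) (m ∸ i)) (+-comm k 1))
  (trans (cong (at (A ++ y ∷ B)) (sym hp)) (at-mid A y B))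

unbarred-claims : ∀ n k r ys zs vs b i → length ys + length zs ≡ k → k + length vs ≡ n → k < n →
  length ys ≡ k ∸ r → length vs ≡ n ∸ k → 1 ≤ i → i ≤ k → r < i → RowClaims n k r ys zs vs b i
unbarred-claims n k r ys zs vs b i hk hn k<n |ys| |vs| 1≤i i≤k r<i
  with split-at ys (suc k ∸ i) (m<n⇒0<n∸m (s≤s i≤k)) (subst (suc k ∸ i ≤_) (sym |ys|) (∸-monoʳ-≤ (suc k) r<i))
... | A , y , B , refl , hp
  with unbarred-row n k (suc k ∸ i) A y B zs vs b hk hn k<n hp (position-≤ k i 1≤i)
... | tail , head , arrows =
  (λ i≤r → ⊥-elim (<⇒≱ r<i i≤r))
  , (λ _ → trans tail (cong (λ t → count (_<ᵇ t) vs) (sym (at-row k i A y B hp))) , head)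
  , (λ full → arrows (trans full (sym |vs|)))

lemma3p14 : (n k r : ℕ) → 1 ≤ k → k < n → r ≤ k →
    (ys zs vs : List ℕ) (b : Bool) →
    length ys ≡ k ∸ r → length zs ≡ r → length vs ≡ n ∸ k →
    Linked _<_ ys → Linked _<_ zs → Linked _<_ vs →
    (ys ++ zs ++ vs) ↭ between 1 n →
    2 ∣ numBarred (ogWord ys zs vs b) →
    (i : ℕ) → 1 ≤ i → i ≤ k →
      (i ≤ r →
        (S1 n k (inversionSet n (ogWord ys zs vs b)) i
           ≡ (n ∸ k) + count (λ v → at zs i <ᵇ v) vs)
        × (S2 k (inversionSet n (ogWord ys zs vs b)) i
           ≡ count (λ z → at zs i <ᵇ z) zs + count (λ y → at zs i <ᵇ y) ys))
      × (r < i →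
        (S1 n k (inversionSet n (ogWord ys zs vs b)) i
           ≡ count (λ v → v <ᵇ at ys (k + 1 ∸ i)) vs)
        × (S2 k (inversionSet n (ogWord ys zs vs b)) i ≡ 0))
      × (S1 n k (inversionSet n (ogWord ys zs vs b)) i ≡ n ∸ k →
        (proj₁ (entry (ogWord ys zs vs b) n) ≡ false →
           Assigned n k (inversionSet n (ogWord ys zs vs b)) i ↑)
        × (proj₁ (entry (ogWord ys zs vs b) n) ≡ true →
           Assigned n k (inversionSet n (ogWord ys zs vs b)) i ↓))
lemma3p14 n k r _ k<n r≤k ys zs vs b |ys| |zs| |vs| _ zs-sorted _ perm _ i 1≤i i≤k = claims (i ≤? r)
  where
  hk : length ys + length zs ≡ k
  hk = trans (cong₂ _+_ |ys| |zs|) (m∸n+n≡m r≤k)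
  hn : k + length vs ≡ n
  hn = trans (cong (k +_) |vs|) (m+[n∸m]≡n (<⇒≤ k<n))
  distinct : Unique (ys ++ zs ++ vs)
  distinct = unique-resp-↭ (↭-sym perm) (unique-between n)
  claims : Dec (i ≤ r) → RowClaims n k r ys zs vs b i
  claims (yes i≤r) = barred-claims n k r ys zs vs b i hk hn k<n |zs| |vs| distinct zs-sorted 1≤i i≤r
  claims (no i≰r)  = unbarred-claims n k r ys zs vs b i hk hn k<n |ys| |vs| 1≤i i≤k (≰⇒> i≰r)
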